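{- Let $n\geq 1$ and $S\subseteq [n-1]$. Then $$\#\{w\in\mathfrak{S}_n : S\subseteq C(w)\} = \eta(S)\qquad\text{and}\qquad \#\{w\in\mathfrak{S}_n : S\supseteq D(w)\} = \frac{n!}{\eta(S)}.$$
   Context: $[n]=\{1,\dots,n\}$ and $\mathfrak{S}_n$ is the set of permutations $w=a_1a_2\cdots a_n$ of $[n]$ (one-line notation). The descent set is $D(w)=\{i : a_i>a_{i+1}\}\subseteq[n-1]$. The connectivity set is $C(w)=\{i\in[n-1] : a_j<a_k \text{ for all } j\leq i<k\}$. For $S=\{i_1,\dots,i_k\}\subseteq[n-1]$ with $i_1<\cdots<i_k$, define $\eta(S)=i_1!\,(i_2-i_1)!\cdots(i_k-i_{k-1})!\,(n-i_k)!$ (so $\eta(\emptyset)=n!$). -}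

module Defs where

open import Data.Bool using (Bool; true; false; _∧_; if_then_else_)
open import Data.Nat using (ℕ; zero; suc; _∸_; _*_; _!; NonZero)
open import Data.Nat.Properties using (_!≢0; m*n≢0)
import Data.Nat as ℕ
open import Data.Fin using (Fin; toℕ; inject₁) renaming (suc to fsuc)
open import Data.Fin.Properties using (_≟_)
import Data.Fin as F
open import Data.Fin.Subset using (Subset)
open import Data.Vec using (Vec; []; _∷_; lookup)
open import Data.List using (List; []; _∷_; map; concatMap; allFin; filterᵇ; length)
open import Data.Bool.ListAction using (all)
open import Data.Nat.ListAction using (product)
open import Relation.Nullary.Decidable using (⌊_⌋)

-- A word  w = a_1 a_2 ... a_n  with letters in [n] is a  Vec (Fin n) n ;
-- position i (1-based) is stored at index i-1, and the letter k ∈ [n]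
-- is represented by the Fin n element with toℕ = k-1 (order-preserving).

allWords : ∀ {n} k → List (Vec (Fin n) k)
allWords zero    = [] ∷ []
allWords {n} (suc k) = concatMap (λ a → map (a ∷_) (allWords k)) (allFin n)

-- w is a permutation iff its letters are pairwise distinct
-- (injective Fin n → Fin n, hence bijective)
isPerm : ∀ {n} → Vec (Fin n) n → Bool
isPerm {n} w =
  all (λ i → all (λ j → if ⌊ lookup w i ≟ lookup w j ⌋ then ⌊ i ≟ j ⌋ else true)
                 (allFin n))
      (allFin n)

𝔖 : ∀ n → List (Vec (Fin n) n)
𝔖 n = filterᵇ isPerm (allWords n)

#𝔖 : ∀ n → (Vec (Fin n) n → Bool) → ℕ
#𝔖 n P = length (filterᵇ P (𝔖 n))

-- Subsets S ⊆ [n-1] for n = suc m are  Subset m ;  the index j : Fin m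
-- stands for the element  i = toℕ j + 1  of [n-1] = [m].

-- i ∈ D(w)  with i = toℕ j + 1 :  a_i > a_{i+1}
-- (a_i is at index i-1 = inject₁ j, a_{i+1} at index i = fsuc j)
isDescent : ∀ {m} → Vec (Fin (suc m)) (suc m) → Fin m → Bool
isDescent w j = ⌊ lookup w (fsuc j) F.<? lookup w (inject₁ j) ⌋

-- i ∈ C(w)  (i as a natural number) :  a_p < a_q for all p ≤ i < q,
-- positions p, q being 1-based, i.e. indices x = p-1, y = q-1 with
-- toℕ x < i ≤ toℕ y.
isConnected : ∀ {n} → Vec (Fin n) n → ℕ → Bool
isConnected {n} w i =
  all (λ x → all (λ y → if ⌊ toℕ x ℕ.<? i ⌋ ∧ ⌊ i ℕ.≤? toℕ y ⌋
                        then ⌊ lookup w x F.<? lookup w y ⌋ else true)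
                 (allFin n))
      (allFin n)

subsetOfC : ∀ {m} → Subset m → Vec (Fin (suc m)) (suc m) → Bool
subsetOfC {m} S w =
  all (λ j → if lookup S j then isConnected w (suc (toℕ j)) else true) (allFin m)

DsubsetOf : ∀ {m} → Subset m → Vec (Fin (suc m)) (suc m) → Bool
DsubsetOf {m} S w =
  all (λ j → if isDescent w j then lookup S j else true) (allFin m)

-- η(S) = i_1! (i_2-i_1)! ⋯ (i_k-i_{k-1})! (n-i_k)!

elements : ∀ {m} → Subset m → List ℕ
elements {m} S = Data.List.map (λ j → suc (toℕ j))
                   (filterᵇ (lookup S) (allFin m))

gaps : ℕ → List ℕ → ℕ → List ℕ
gaps prev []       n = (n ∸ prev) ∷ []
gaps prev (x ∷ xs) n = (x ∸ prev) ∷ gaps x xs n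

η : ∀ {m} → Subset m → ℕ
η {m} S = product (map _! (gaps 0 (elements S) (suc m)))

productFact≢0 : ∀ xs → NonZero (product (map _! xs))
productFact≢0 []       = _
productFact≢0 (x ∷ xs) = m*n≢0 (x !) (product (map _! xs)) {{x !≢0}} {{productFact≢0 xs}}

η≢0 : ∀ {m} (S : Subset m) → NonZero (η S)
η≢0 {m} S = productFact≢0 (gaps 0 (elements S) (suc m))

-- S cuts 1, …, n into blocks of sizes b₁, …, bₖ, and η(S) = b₁! ⋯ bₖ!.  Both counts are obtained
-- by building a permutation letter by letter and counting the admissible choices for each letter.
--
-- For an injective word, "every letter before position i is smaller than every letter after it"
-- is equivalent, by pigeonhole, to "the first i letters are exactly 1, …, i".  So S ⊆ C(w) says
-- that each letter is at most the next cut at or after it; the letters placed before it in its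
-- block are also below that cut, so a letter with r letters left in its block has exactly r
-- choices, and the count is ∏ bᵢ!.
--
-- D(w) ⊆ S says that w increases along each block.  Only the first letter of a block is free; an
-- increasing run of length l above a bound can be filled from a available letters in (a choose l)
-- ways, which letter by letter is the hockey-stick identity.  The count is therefore the
-- multinomial coefficient n! / ∏ bᵢ!.
module Submission where

open import Defs
open import Data.Nat using (ℕ; suc; _!; _/_)
open import Data.Fin.Subset using (Subset)
open import Data.Product using (_×_)
open import Relation.Binary.PropositionalEquality using (_≡_)

open import Algebra.Bundles using (CommutativeMonoid)
open import Algebra.Properties.CommutativeSemigroup as CommSemigroupProperties using ()
open import Data.Bool using (Bool; true; false; _∧_; _∨_; not; if_then_else_; T)
open import Data.Bool.ListAction using (all; any; and)
open import Data.Bool.Properties using (T-∧; T-≡; ∧-commutativeMonoid)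
open import Data.Fin using (Fin; toℕ; inject₁; inject≤; fromℕ<) renaming (zero to fzero; suc to fsuc)
open import Data.Fin.Properties
  using (toℕ-injective; toℕ<n; toℕ-inject≤; inject≤-injective; toℕ-fromℕ<; fromℕ<-injective; injective⇒≤)
  renaming (suc-injective to fsuc-injective; _≟_ to _≟ᶠ_; _<?_ to _<?ᶠ_)
open import Data.List using (List; []; _∷_; _++_; map; concatMap; allFin; tabulate; filterᵇ; length)
open import Data.List.Membership.Propositional.Properties using (∈-allFin)
open import Data.List.Properties using (map-tabulate; map-cong; map-∘)
open import Data.List.Relation.Unary.All using () renaming (lookup to All-lookup)
open import Data.List.Relation.Unary.All.Properties using (all⁺; all⁻; tabulate⁺)
open import Data.Nat using (zero; _+_; _*_; _∸_; _≤_; _<_; _⊓_; z≤n; s≤s; s≤s⁻¹; NonZero)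
open import Data.Nat.Combinatorics using (_C_; nCk+nC[k+1]≡[n+1]C[k+1]; nCk≡n!/k![n-k]!; k![n∸k]!∣n!)
open import Data.Nat.DivMod using (m/n*n≡m; m*n/n≡m)
open import Data.Nat.ListAction using (sum; product)
open import Data.Nat.Properties
open import Data.Product using (_,_; proj₁; proj₂)
open import Data.Vec using (Vec; []; _∷_; lookup)
open import Data.Vec.Functional using () renaming (_∷_ to _∷ᶠ_)
open import Function using (_∘_; id)
open import Function.Bundles using (_⇔_; mk⇔; Equivalence)
open import Function.Definitions using (Injective)
open import Relation.Binary.PropositionalEquality
open import Relation.Nullary.Decidable using (Dec; ⌊_⌋; yes; no; toWitness; fromWitness)
open import Relation.Nullary.Negation using (contradiction)

open Equivalence using (to; from)
open CommSemigroupProperties +-commutativeSemigroup using () renaming (interchange to +-interchange)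
open CommSemigroupProperties *-commutativeSemigroup using () renaming (interchange to *-interchange)
open CommSemigroupProperties (CommutativeMonoid.commutativeSemigroup ∧-commutativeMonoid)
  using () renaming (interchange to ∧-interchange)

T-⇔⇒≡ : ∀ {a b} → (T a → T b) → (T b → T a) → a ≡ b
T-⇔⇒≡ {false} {false} _ _ = refl
T-⇔⇒≡ {false} {true}  _ b⇒a = contradiction _ b⇒a
T-⇔⇒≡ {true}  {false} a⇒b _ = contradiction _ a⇒b
T-⇔⇒≡ {true}  {true}  _ _ = refl

T-if-then-true : ∀ b c → T (if b then c else true) ⇔ (T b → T c)
T-if-then-true true  c = mk⇔ (λ t _ → t) (λ f → f _)
T-if-then-true false c = mk⇔ (λ _ ()) (λ _ → _)

T-if-dec : ∀ {A C : Set} (a? : Dec A) (c? : Dec C) → T (if ⌊ a? ⌋ then ⌊ c? ⌋ else true) ⇔ (A → C)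
T-if-dec (yes _) (yes c) = mk⇔ (λ _ _ → c) (λ _ → _)
T-if-dec (yes a) (no ¬c) = mk⇔ (λ ()) (λ a⇒c → ¬c (a⇒c a))
T-if-dec (no ¬a) _       = mk⇔ (λ _ a → contradiction a ¬a) (λ _ → _)

T-if-dec₂ : ∀ {A B C : Set} (a? : Dec A) (b? : Dec B) (c? : Dec C) →
  T (if ⌊ a? ⌋ ∧ ⌊ b? ⌋ then ⌊ c? ⌋ else true) ⇔ (A → B → C)
T-if-dec₂ (yes _) (yes _) (yes c) = mk⇔ (λ _ _ _ → c) (λ _ → _)
T-if-dec₂ (yes a) (yes b) (no ¬c) = mk⇔ (λ ()) (λ f → ¬c (f a b))
T-if-dec₂ (yes _) (no ¬b) _       = mk⇔ (λ _ _ b → contradiction b ¬b) (λ _ → _)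
T-if-dec₂ (no ¬a) _       _       = mk⇔ (λ _ a → contradiction a ¬a) (λ _ → _)

T-all-allFin : ∀ {n} (p : Fin n → Bool) → T (all p (allFin n)) ⇔ (∀ i → T (p i))
T-all-allFin p = mk⇔ (λ t i → All-lookup (all⁺ p _ t) (∈-allFin i)) (λ h → all⁻ p (tabulate⁺ h))

all-allFin-suc : ∀ {k} (p : Fin (suc k) → Bool) →
  all p (allFin (suc k)) ≡ p fzero ∧ all (p ∘ fsuc) (allFin k)
all-allFin-suc {k} p =
  cong (λ bs → p fzero ∧ and bs) (trans (map-tabulate fsuc p) (sym (map-tabulate {n = k} id (p ∘ fsuc))))

filterᵇ-map : ∀ {A B : Set} (p : B → Bool) (f : A → B) xs →
  filterᵇ p (map f xs) ≡ map f (filterᵇ (p ∘ f) xs)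
filterᵇ-map p f []       = refl
filterᵇ-map p f (x ∷ xs) with p (f x)
... | true  = cong (f x ∷_) (filterᵇ-map p f xs)
... | false = filterᵇ-map p f xs

-- Sums over initial segments of ℕ

𝟙 : Bool → ℕ
𝟙 true  = 1
𝟙 false = 0

∑< : ℕ → (ℕ → ℕ) → ℕ
∑< zero    f = 0
∑< (suc N) f = ∑< N f + f N

infix 5 ∑<

syntax ∑< N (λ x → t) = ∑[ x < N ] t

∑-cong : ∀ N {f g : ℕ → ℕ} → (∀ x → x < N → f x ≡ g x) → ∑< N f ≡ ∑< N g
∑-cong zero    f≗g = refl
∑-cong (suc N) f≗g = cong₂ _+_ (∑-cong N (λ x x<N → f≗g x (m<n⇒m<1+n x<N))) (f≗g N ≤-refl)

∑-zero : ∀ N {f : ℕ → ℕ} → (∀ x → x < N → f x ≡ 0) → ∑< N f ≡ 0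
∑-zero zero    f≗0 = refl
∑-zero (suc N) f≗0 = cong₂ _+_ (∑-zero N (λ x x<N → f≗0 x (m<n⇒m<1+n x<N))) (f≗0 N ≤-refl)

∑-const : ∀ N → ∑[ x < N ] 1 ≡ N
∑-const zero    = refl
∑-const (suc N) = trans (cong (_+ 1) (∑-const N)) (+-comm N 1)

∑-distrib-+ : ∀ N (f g : ℕ → ℕ) → ∑[ x < N ] (f x + g x) ≡ ∑< N f + ∑< N g
∑-distrib-+ zero    f g = refl
∑-distrib-+ (suc N) f g =
  trans (cong (_+ (f N + g N)) (∑-distrib-+ N f g)) (+-interchange (∑< N f) (∑< N g) (f N) (g N))

∑-distribʳ-* : ∀ N (f : ℕ → ℕ) c → ∑[ x < N ] (f x * c) ≡ ∑< N f * c
∑-distribʳ-* zero    f c = refl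
∑-distribʳ-* (suc N) f c =
  trans (cong (_+ f N * c) (∑-distribʳ-* N f c)) (sym (*-distribʳ-+ c (∑< N f) (f N)))

∑-delta : ∀ N a → a < N → ∑[ x < N ] 𝟙 ⌊ x ≟ a ⌋ ≡ 1
∑-delta (suc N) a a<1+N with N ≟ a
... | yes refl = cong (_+ 1) (∑-zero N (λ x x<N → 𝟙-≢ x N (<⇒≢ x<N)))
  where
  𝟙-≢ : ∀ x a → x ≢ a → 𝟙 ⌊ x ≟ a ⌋ ≡ 0
  𝟙-≢ x a x≢a with x ≟ a
  ... | yes x≡a = contradiction x≡a x≢a
  ... | no _    = refl
... | no N≢a   = trans (+-identityʳ _) (∑-delta N a (≤∧≢⇒< (s≤s⁻¹ a<1+N) (N≢a ∘ sym)))

∑-front : ∀ N (f : ℕ → ℕ) → ∑< (suc N) f ≡ f 0 + ∑< N (f ∘ suc)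
∑-front zero    f = +-comm 0 (f 0)
∑-front (suc N) f = trans (cong (_+ f (suc N)) (∑-front N f)) (+-assoc (f 0) _ (f (suc N)))

∑-tabulate : ∀ N (f : ℕ → ℕ) → sum (tabulate {n = N} (f ∘ toℕ)) ≡ ∑< N f
∑-tabulate zero    f = refl
∑-tabulate (suc N) f = trans (cong (f 0 +_) (∑-tabulate N (f ∘ suc))) (sym (∑-front N f))

∑-allFin : ∀ N (f : ℕ → ℕ) → sum (map (f ∘ toℕ) (allFin N)) ≡ ∑< N f
∑-allFin N f = trans (cong sum (map-tabulate {n = N} id (f ∘ toℕ))) (∑-tabulate N f)

∑-below : ∀ N b → b ≤ N → ∑[ y < N ] 𝟙 ⌊ y <? b ⌋ ≡ b
∑-below N b b≤N = trans (∑-below-⊓ N) (m≥n⇒m⊓n≡n b≤N)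
  where
  ∑-below-⊓ : ∀ N → ∑[ y < N ] 𝟙 ⌊ y <? b ⌋ ≡ N ⊓ b
  ∑-below-⊓ zero    = refl
  ∑-below-⊓ (suc N) with N <? b
  ... | yes N<b = trans (cong (_+ 1) (trans (∑-below-⊓ N) (m≤n⇒m⊓n≡m (<⇒≤ N<b))))
                        (trans (+-comm N 1) (sym (m≤n⇒m⊓n≡m N<b)))
  ... | no N≮b  = trans (+-identityʳ _) (trans (∑-below-⊓ N)
                        (trans (m≥n⇒m⊓n≡n N≥b) (sym (m≥n⇒m⊓n≡n (m≤n⇒m≤1+n N≥b)))))
    where
    N≥b : b ≤ N
    N≥b = ≮⇒≥ N≮b

∑-from-empty : ∀ N lo (t : ℕ → ℕ) → N ≤ lo → ∑[ x < N ] 𝟙 ⌊ lo ≤? x ⌋ * t x ≡ 0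
∑-from-empty N lo t N≤lo = ∑-zero N λ x x<N → vanish x (<-≤-trans x<N N≤lo)
  where
  vanish : ∀ x → x < lo → 𝟙 ⌊ lo ≤? x ⌋ * t x ≡ 0
  vanish x x<lo with lo ≤? x
  ... | yes lo≤x = contradiction x<lo (≤⇒≯ lo≤x)
  ... | no _     = refl

∑-from-split : ∀ N lo (t : ℕ → ℕ) → lo < N →
  ∑[ x < N ] 𝟙 ⌊ lo ≤? x ⌋ * t x ≡ t lo + (∑[ x < N ] 𝟙 ⌊ suc lo ≤? x ⌋ * t x)
∑-from-split N lo t lo<N = begin
  ∑[ x < N ] 𝟙 ⌊ lo ≤? x ⌋ * t x
    ≡⟨ ∑-cong N (λ x _ → pointwise x) ⟩
  ∑[ x < N ] (𝟙 ⌊ x ≟ lo ⌋ * t lo + 𝟙 ⌊ suc lo ≤? x ⌋ * t x)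
    ≡⟨ ∑-distrib-+ N _ _ ⟩
  (∑[ x < N ] 𝟙 ⌊ x ≟ lo ⌋ * t lo) + (∑[ x < N ] 𝟙 ⌊ suc lo ≤? x ⌋ * t x)
    ≡⟨ cong (_+ rest) (trans (∑-distribʳ-* N _ (t lo)) (cong (_* t lo) (∑-delta N lo lo<N))) ⟩
  1 * t lo + (∑[ x < N ] 𝟙 ⌊ suc lo ≤? x ⌋ * t x)
    ≡⟨ cong (_+ rest) (*-identityˡ (t lo)) ⟩
  t lo + (∑[ x < N ] 𝟙 ⌊ suc lo ≤? x ⌋ * t x) ∎
  where
  open ≡-Reasoning
  rest : ℕ
  rest = ∑[ x < N ] 𝟙 ⌊ suc lo ≤? x ⌋ * t x
  pointwise : ∀ x → 𝟙 ⌊ lo ≤? x ⌋ * t x ≡ 𝟙 ⌊ x ≟ lo ⌋ * t lo + 𝟙 ⌊ suc lo ≤? x ⌋ * t x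
  pointwise x with lo ≤? x | suc lo ≤? x | x ≟ lo
  ... | _        | yes lo<x | yes refl = contradiction lo<x (n≮n lo)
  ... | yes _    | yes _    | no _     = refl
  ... | yes _    | no _     | yes refl = sym (+-identityʳ _)
  ... | yes lo≤x | no lo≮x  | no x≢lo  = contradiction (≤∧≢⇒< lo≤x (x≢lo ∘ sym)) lo≮x
  ... | no lo≰x  | _        | yes refl = contradiction ≤-refl lo≰x
  ... | no lo≰x  | yes lo<x | no _     = contradiction (<⇒≤ lo<x) lo≰x
  ... | no _     | no _     | no _     = refl

-- Binomial and multinomial coefficients

module _ (N : ℕ) (g : ℕ → Bool) where

  #from : ℕ → ℕ
  #from lo = ∑[ x < N ] 𝟙 ⌊ lo ≤? x ⌋ * 𝟙 (g x)

  -- A (suc c)-subset of {x ≥ lo ∣ g x} is its least element x together with a c-subset of {y > x ∣ g y}.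
  hockey-stick : ∀ lo c → ∑[ x < N ] 𝟙 ⌊ lo ≤? x ⌋ * (𝟙 (g x) * (#from (suc x) C c)) ≡ #from lo C suc c
  hockey-stick lo c = by-distance N lo (m≤n+m N lo)
    where
    bySmallest : ℕ → ℕ
    bySmallest lo = ∑[ x < N ] 𝟙 ⌊ lo ≤? x ⌋ * (𝟙 (g x) * (#from (suc x) C c))
    beyond : ∀ lo → N ≤ lo → bySmallest lo ≡ #from lo C suc c
    beyond lo N≤lo = trans (∑-from-empty N lo _ N≤lo) (sym (cong (_C suc c) (∑-from-empty N lo (𝟙 ∘ g) N≤lo)))
    pascal : ∀ b m → 𝟙 b * (m C c) + m C suc c ≡ (𝟙 b + m) C suc c
    pascal true  m = trans (cong (_+ m C suc c) (*-identityˡ (m C c))) (nCk+nC[k+1]≡[n+1]C[k+1] m c)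
    pascal false m = refl
    by-distance : ∀ r lo → N ≤ lo + r → bySmallest lo ≡ #from lo C suc c
    by-distance zero    lo N≤lo+0 = beyond lo (subst (N ≤_) (+-identityʳ lo) N≤lo+0)
    by-distance (suc r) lo N≤lo+1+r with lo <? N
    ... | no lo≮N  = beyond lo (≮⇒≥ lo≮N)
    ... | yes lo<N = begin
      bySmallest lo
        ≡⟨ ∑-from-split N lo _ lo<N ⟩
      𝟙 (g lo) * (#from (suc lo) C c) + bySmallest (suc lo)
        ≡⟨ cong (𝟙 (g lo) * (#from (suc lo) C c) +_)
                (by-distance r (suc lo) (subst (N ≤_) (+-suc lo r) N≤lo+1+r)) ⟩
      𝟙 (g lo) * (#from (suc lo) C c) + #from (suc lo) C suc c
        ≡⟨ pascal (g lo) (#from (suc lo)) ⟩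
      (𝟙 (g lo) + #from (suc lo)) C suc c
        ≡⟨ cong (_C suc c) (∑-from-split N lo (𝟙 ∘ g) lo<N) ⟨
      #from lo C suc c ∎
      where open ≡-Reasoning

binomial-factorial : ∀ m k → ((m + k) C m) * (m ! * k !) ≡ (m + k) !
binomial-factorial m k = begin
  ((m + k) C m) * (m ! * k !)
    ≡⟨ cong (λ j → ((m + k) C m) * (m ! * j !)) (m+n∸m≡n m k) ⟨
  ((m + k) C m) * (m ! * (m + k ∸ m) !)
    ≡⟨ cong (_* (m ! * (m + k ∸ m) !)) (nCk≡n!/k![n-k]! (m≤m+n m k)) ⟩
  ((m + k) ! / (m ! * (m + k ∸ m) !)) * (m ! * (m + k ∸ m) !)
    ≡⟨ m/n*n≡m (k![n∸k]!∣n! (m≤m+n m k)) ⟩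
  (m + k) ! ∎
  where
  open ≡-Reasoning
  instance
    factorials≢0 : NonZero (m ! * (m + k ∸ m) !)
    factorials≢0 = m !* (m + k ∸ m) !≢0

multinomial : ℕ → List ℕ → ℕ
multinomial M []       = 1
multinomial M (l ∷ ls) = (M C l) * multinomial (M ∸ l) ls

multinomial-factorials : ∀ ls → multinomial (sum ls) ls * product (map _! ls) ≡ (sum ls) !
multinomial-factorials []       = refl
multinomial-factorials (l ∷ ls) = begin
  ((l + s) C l) * multinomial (l + s ∸ l) ls * (l ! * product (map _! ls))
    ≡⟨ cong (λ j → ((l + s) C l) * multinomial j ls * (l ! * product (map _! ls))) (m+n∸m≡n l s) ⟩
  ((l + s) C l) * multinomial s ls * (l ! * product (map _! ls))
    ≡⟨ *-interchange ((l + s) C l) (multinomial s ls) (l !) (product (map _! ls)) ⟩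
  ((l + s) C l) * l ! * (multinomial s ls * product (map _! ls))
    ≡⟨ cong (((l + s) C l) * l ! *_) (multinomial-factorials ls) ⟩
  ((l + s) C l) * l ! * s !
    ≡⟨ *-assoc ((l + s) C l) (l !) (s !) ⟩
  ((l + s) C l) * (l ! * s !)
    ≡⟨ binomial-factorial l s ⟩
  (l + s) ! ∎
  where
  open ≡-Reasoning
  s : ℕ
  s = sum ls

-- Counting words letter by letter

count : ∀ {A : Set} → (A → Bool) → List A → ℕ
count p []       = 0
count p (x ∷ xs) = 𝟙 (p x) + count p xs

module _ {A : Set} where

  length-filterᵇ : ∀ (p : A → Bool) xs → length (filterᵇ p xs) ≡ count p xs
  length-filterᵇ p []       = refl
  length-filterᵇ p (x ∷ xs) with p x
  ... | true  = cong suc (length-filterᵇ p xs)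
  ... | false = length-filterᵇ p xs

  count-filterᵇ : ∀ (p q : A → Bool) xs → count p (filterᵇ q xs) ≡ count (λ x → q x ∧ p x) xs
  count-filterᵇ p q []       = refl
  count-filterᵇ p q (x ∷ xs) with q x
  ... | true  = cong (𝟙 (p x) +_) (count-filterᵇ p q xs)
  ... | false = count-filterᵇ p q xs

  count-++ : ∀ (p : A → Bool) xs ys → count p (xs ++ ys) ≡ count p xs + count p ys
  count-++ p []       ys = refl
  count-++ p (x ∷ xs) ys = trans (cong (𝟙 (p x) +_) (count-++ p xs ys)) (sym (+-assoc (𝟙 (p x)) _ _))

  count-map : ∀ {B : Set} (p : B → Bool) (f : A → B) xs → count p (map f xs) ≡ count (p ∘ f) xs
  count-map p f []       = refl
  count-map p f (x ∷ xs) = cong (𝟙 (p (f x)) +_) (count-map p f xs)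

  count-cong : ∀ {p q : A → Bool} → (∀ x → p x ≡ q x) → ∀ xs → count p xs ≡ count q xs
  count-cong p≗q []       = refl
  count-cong p≗q (x ∷ xs) = cong₂ _+_ (cong 𝟙 (p≗q x)) (count-cong p≗q xs)

  count-const∧ : ∀ b (p : A → Bool) xs → count (λ x → b ∧ p x) xs ≡ 𝟙 b * count p xs
  count-const∧ true  p xs       = sym (+-identityʳ _)
  count-const∧ false p []       = refl
  count-const∧ false p (x ∷ xs) = count-const∧ false p xs

count-allWords : ∀ {n k} (p : Vec (Fin n) (suc k) → Bool) (g : ℕ → ℕ) →
  (∀ a → count (p ∘ (a ∷_)) (allWords k) ≡ g (toℕ a)) →
  count p (allWords (suc k)) ≡ ∑< n g
count-allWords {n} {k} p g count≡g = begin
  count p (concatMap (λ a → map (a ∷_) (allWords k)) (allFin n))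
    ≡⟨ count-concatMap (allFin n) ⟩
  sum (map (λ a → count (p ∘ (a ∷_)) (allWords k)) (allFin n))
    ≡⟨ cong sum (map-cong count≡g (allFin n)) ⟩
  sum (map (g ∘ toℕ) (allFin n))
    ≡⟨ ∑-allFin n g ⟩
  ∑< n g ∎
  where
  open ≡-Reasoning
  count-concatMap : ∀ as → count p (concatMap (λ a → map (a ∷_) (allWords k)) as)
                         ≡ sum (map (λ a → count (p ∘ (a ∷_)) (allWords k)) as)
  count-concatMap []       = refl
  count-concatMap (a ∷ as) = trans (count-++ p (map (a ∷_) (allWords k)) _)
    (cong₂ _+_ (count-map p (a ∷_) (allWords k)) (count-concatMap as))

_∈ᵇ_ : ℕ → List ℕ → Bool
x ∈ᵇ U = any (λ u → ⌊ x ≟ u ⌋) U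

T-∉ᵇ-∷ : ∀ x a U → T (not (x ∈ᵇ (a ∷ U))) ⇔ (x ≢ a × T (not (x ∈ᵇ U)))
T-∉ᵇ-∷ x a U with x ≟ a
... | yes x≡a = mk⇔ (λ ()) (λ (x≢a , _) → contradiction x≡a x≢a)
... | no x≢a  = mk⇔ (x≢a ,_) proj₂

-- U holds the letters placed before w, as naturals.
fresh : ∀ {n k} → List ℕ → Vec (Fin n) k → Bool
fresh U []      = true
fresh U (a ∷ w) = not (toℕ a ∈ᵇ U) ∧ fresh (toℕ a ∷ U) w

module _ {n : ℕ} where

  Avoids : ∀ {k} → List ℕ → Vec (Fin n) k → Set
  Avoids U w = ∀ i → T (not (toℕ (lookup w i) ∈ᵇ U))

  fresh⇒ : ∀ {k} U (w : Vec (Fin n) k) → T (fresh U w) → Injective _≡_ _≡_ (lookup w) × Avoids U w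
  fresh⇒ U []      _ = (λ {}) , λ ()
  fresh⇒ U (a ∷ w) t = injective , avoids
    where
    IH : Injective _≡_ _≡_ (lookup w) × Avoids (toℕ a ∷ U) w
    IH = fresh⇒ (toℕ a ∷ U) w (proj₂ (to T-∧ t))
    injective : Injective _≡_ _≡_ (lookup (a ∷ w))
    injective {fzero}  {fzero}  _  = refl
    injective {fzero}  {fsuc j} eq = contradiction (cong toℕ (sym eq)) (proj₁ (to (T-∉ᵇ-∷ _ _ U) (proj₂ IH j)))
    injective {fsuc i} {fzero}  eq = contradiction (cong toℕ eq)       (proj₁ (to (T-∉ᵇ-∷ _ _ U) (proj₂ IH i)))
    injective {fsuc i} {fsuc j} eq = cong fsuc (proj₁ IH eq)
    avoids : Avoids U (a ∷ w)
    avoids fzero    = proj₁ (to T-∧ t)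
    avoids (fsuc i) = proj₂ (to (T-∉ᵇ-∷ _ _ U) (proj₂ IH i))

  fresh⇐ : ∀ {k} U (w : Vec (Fin n) k) → Injective _≡_ _≡_ (lookup w) → Avoids U w → T (fresh U w)
  fresh⇐ U []      _         _      = _
  fresh⇐ U (a ∷ w) injective avoids =
    from T-∧ (avoids fzero , fresh⇐ (toℕ a ∷ U) w (fsuc-injective ∘ injective) avoids-w)
    where
    avoids-w : Avoids (toℕ a ∷ U) w
    avoids-w i = from (T-∉ᵇ-∷ _ _ U)
      ((λ eq → contradiction (injective {fsuc i} {fzero} (toℕ-injective eq)) λ ()) , avoids (fsuc i))

  isPerm⇔injective : (w : Vec (Fin n) n) → T (isPerm w) ⇔ Injective _≡_ _≡_ (lookup w)
  isPerm⇔injective w = mk⇔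
    (λ t {i} {j} → to (entry i j) (to (T-all-allFin (test i)) (to (T-all-allFin row) t i) j))
    (λ injective → from (T-all-allFin row) λ i → from (T-all-allFin (test i)) λ j →
       from (entry i j) injective)
    where
    test : Fin n → Fin n → Bool
    test i j = if ⌊ lookup w i ≟ᶠ lookup w j ⌋ then ⌊ i ≟ᶠ j ⌋ else true
    row : Fin n → Bool
    row i = all (test i) (allFin n)
    entry : ∀ i j → T (test i j) ⇔ (lookup w i ≡ lookup w j → i ≡ j)
    entry i j = T-if-dec (lookup w i ≟ᶠ lookup w j) (i ≟ᶠ j)

  isPerm≡fresh : (w : Vec (Fin n) n) → isPerm w ≡ fresh [] w
  isPerm≡fresh w = T-⇔⇒≡
    (λ t → fresh⇐ [] w (to (isPerm⇔injective w) t) (λ _ → _))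
    (λ t → from (isPerm⇔injective w) (proj₁ (fresh⇒ [] w t)))

#𝔖≡count : ∀ n (P : Vec (Fin n) n → Bool) → #𝔖 n P ≡ count (λ w → fresh [] w ∧ P w) (allWords {n} n)
#𝔖≡count n P = begin
  length (filterᵇ P (filterᵇ isPerm words))  ≡⟨ length-filterᵇ P (filterᵇ isPerm words) ⟩
  count P (filterᵇ isPerm words)             ≡⟨ count-filterᵇ P isPerm words ⟩
  count (λ w → isPerm w ∧ P w) words          ≡⟨ count-cong (λ w → cong (_∧ P w) (isPerm≡fresh w)) words ⟩
  count (λ w → fresh [] w ∧ P w) words        ∎
  where
  open ≡-Reasoning
  words : List (Vec (Fin n) n)
  words = allWords n

𝟙∧*-cong : ∀ b₁ b₂ {m c} → (T b₁ → T b₂ → m ≡ c) →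
  𝟙 (b₁ ∧ b₂) * m ≡ 𝟙 b₂ * (𝟙 b₁ * c)
𝟙∧*-cong true  true  m≡c = cong (_+ 0) (trans (m≡c _ _) (sym (+-identityʳ _)))
𝟙∧*-cong true  false _   = refl
𝟙∧*-cong false b₂    _   = sym (*-zeroʳ (𝟙 b₂))

module _ (n : ℕ) where

  avail : List ℕ → (ℕ → Bool) → ℕ
  avail U P = ∑[ x < n ] 𝟙 (P x) * 𝟙 (not (x ∈ᵇ U))

  avail-∷ : ∀ U (P : ℕ → Bool) a → a < n → T (P a) → T (not (a ∈ᵇ U)) →
    avail (a ∷ U) P + 1 ≡ avail U P
  avail-∷ U P a a<n Pa a∉U = begin
    avail (a ∷ U) P + 1
      ≡⟨ cong (avail (a ∷ U) P +_) (∑-delta n a a<n) ⟨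
    avail (a ∷ U) P + (∑[ x < n ] 𝟙 ⌊ x ≟ a ⌋)
      ≡⟨ ∑-distrib-+ n _ _ ⟨
    ∑[ x < n ] (𝟙 (P x) * 𝟙 (not (⌊ x ≟ a ⌋ ∨ x ∈ᵇ U)) + 𝟙 ⌊ x ≟ a ⌋)
      ≡⟨ ∑-cong n (λ x _ → pointwise x) ⟩
    avail U P ∎
    where
    open ≡-Reasoning
    pointwise : ∀ x → 𝟙 (P x) * 𝟙 (not (⌊ x ≟ a ⌋ ∨ x ∈ᵇ U)) + 𝟙 ⌊ x ≟ a ⌋ ≡ 𝟙 (P x) * 𝟙 (not (x ∈ᵇ U))
    pointwise x with x ≟ a
    ... | yes refl rewrite to T-≡ Pa | to T-≡ a∉U = refl
    ... | no _     = +-identityʳ _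

  avail-∷-∸ : ∀ U (P : ℕ → Bool) a → a < n → T (P a) → T (not (a ∈ᵇ U)) →
    ∀ l → avail (a ∷ U) P ∸ l ≡ avail U P ∸ suc l
  avail-∷-∸ U P a a<n Pa a∉U l = cong (_∸ suc l) (trans (+-comm 1 _) (avail-∷ U P a a<n Pa a∉U))

  count-fresh-∷ : ∀ {k} U (p : Vec (Fin n) (suc k) → Bool) (h : ℕ → Bool) (q : ℕ → Vec (Fin n) k → Bool)
    (c : ℕ → ℕ) → (∀ a w → p (a ∷ w) ≡ h (toℕ a) ∧ q (toℕ a) w) →
    (∀ x → x < n → T (h x) → T (not (x ∈ᵇ U)) → count (λ w → fresh (x ∷ U) w ∧ q x w) (allWords k) ≡ c x) →
    count (λ w → fresh U w ∧ p w) (allWords (suc k)) ≡ ∑[ x < n ] 𝟙 (h x) * (𝟙 (not (x ∈ᵇ U)) * c x)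
  count-fresh-∷ {k} U p h q c p-∷ count-tail = count-allWords (λ w → fresh U w ∧ p w) _ λ a →
    let x = toℕ a in begin
    count (λ w → fresh U (a ∷ w) ∧ p (a ∷ w)) (allWords k)
      ≡⟨ count-cong (regroup a) (allWords k) ⟩
    count (λ w → (not (x ∈ᵇ U) ∧ h x) ∧ (fresh (x ∷ U) w ∧ q x w)) (allWords k)
      ≡⟨ count-const∧ (not (x ∈ᵇ U) ∧ h x) (λ w → fresh (x ∷ U) w ∧ q x w) (allWords k) ⟩
    𝟙 (not (x ∈ᵇ U) ∧ h x) * count (λ w → fresh (x ∷ U) w ∧ q x w) (allWords k)
      ≡⟨ 𝟙∧*-cong _ _ (λ x∉U hx → count-tail x (toℕ<n a) hx x∉U) ⟩
    𝟙 (h x) * (𝟙 (not (x ∈ᵇ U)) * c x) ∎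
    where
    open ≡-Reasoning
    regroup : ∀ a w → fresh U (a ∷ w) ∧ p (a ∷ w)
                        ≡ (not (toℕ a ∈ᵇ U) ∧ h (toℕ a)) ∧ (fresh (toℕ a ∷ U) w ∧ q (toℕ a) w)
    regroup a w = trans (cong (fresh U (a ∷ w) ∧_) (p-∷ a w))
      (∧-interchange (not (toℕ a ∈ᵇ U)) (fresh (toℕ a ∷ U) w) (h (toℕ a)) (q (toℕ a) w))

-- Blocks of a cut vector

-- A cut vector fs : Vec Bool k cuts a word of length suc k: fs j tells whether there is a cut between
-- letters j and j+1.  blockSizes fs lists the block lengths; initialRun fs is the number of letters
-- following the first one in its block.
initialRun : ∀ {k} → Vec Bool k → ℕ
initialRun []           = 0
initialRun (true ∷ _)   = 0
initialRun (false ∷ fs) = suc (initialRun fs)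

laterBlocks : ∀ {k} → Vec Bool k → List ℕ
laterBlocks []           = []
laterBlocks (true ∷ fs)  = suc (initialRun fs) ∷ laterBlocks fs
laterBlocks (false ∷ fs) = laterBlocks fs

blockSizes : ∀ {k} → Vec Bool k → List ℕ
blockSizes fs = suc (initialRun fs) ∷ laterBlocks fs

initialRun≤ : ∀ {k} (fs : Vec Bool k) → initialRun fs ≤ k
initialRun≤ []           = z≤n
initialRun≤ (true ∷ fs)  = z≤n
initialRun≤ (false ∷ fs) = s≤s (initialRun≤ fs)

sum-blockSizes : ∀ {k} (fs : Vec Bool k) → sum (blockSizes fs) ≡ suc k
sum-blockSizes fs = cong suc (run+later fs)
  where
  run+later : ∀ {k} (fs : Vec Bool k) → initialRun fs + sum (laterBlocks fs) ≡ k
  run+later []           = refl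
  run+later (true ∷ fs)  = cong suc (run+later fs)
  run+later (false ∷ fs) = cong suc (run+later fs)

blockSizes-∷ : ∀ {k} f (fs : Vec Bool k) →
  suc (initialRun (f ∷ fs)) * product (map _! (blockSizes fs)) ≡ product (map _! (blockSizes (f ∷ fs)))
blockSizes-∷ true  fs = refl
blockSizes-∷ false fs = sym (*-assoc (suc (suc (initialRun fs))) (suc (initialRun fs) !) _)

-- cutsFrom 0 S is elements S.
cutsFrom : ∀ {k} → ℕ → Vec Bool k → List ℕ
cutsFrom {k} x S = map (λ j → x + suc (toℕ j)) (filterᵇ (lookup S) (allFin k))

cutsFrom-tail : ∀ {k} x s (S : Vec Bool k) →
  map (λ j → x + suc (toℕ j)) (filterᵇ (lookup (s ∷ S)) (tabulate fsuc)) ≡ cutsFrom (suc x) S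
cutsFrom-tail {k} x s S = begin
  map (λ j → x + suc (toℕ j)) (filterᵇ (lookup (s ∷ S)) (tabulate fsuc))
    ≡⟨ cong (map (λ j → x + suc (toℕ j)) ∘ filterᵇ (lookup (s ∷ S))) (map-tabulate {n = k} id fsuc) ⟨
  map (λ j → x + suc (toℕ j)) (filterᵇ (lookup (s ∷ S)) (map fsuc (allFin k)))
    ≡⟨ cong (map (λ j → x + suc (toℕ j))) (filterᵇ-map (lookup (s ∷ S)) fsuc (allFin k)) ⟩
  map (λ j → x + suc (toℕ j)) (map fsuc (filterᵇ (lookup S) (allFin k)))
    ≡⟨ map-∘ (filterᵇ (lookup S) (allFin k)) ⟨
  map (λ j → x + suc (suc (toℕ j))) (filterᵇ (lookup S) (allFin k))
    ≡⟨ map-cong (λ j → +-suc x (suc (toℕ j))) (filterᵇ (lookup S) (allFin k)) ⟩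
  cutsFrom (suc x) S ∎
  where open ≡-Reasoning

cutsFrom-∷ : ∀ {k} x s (S : Vec Bool k) →
  cutsFrom x (s ∷ S) ≡ (if s then x + 1 ∷ cutsFrom (suc x) S else cutsFrom (suc x) S)
cutsFrom-∷ {k} x true  S = cong (x + 1 ∷_) (cutsFrom-tail x true S)
cutsFrom-∷ {k} x false S = cutsFrom-tail x false S

gaps-cutsFrom : ∀ {k} prev x (S : Vec Bool k) → prev ≤ x →
  gaps prev (cutsFrom x S) (x + suc k) ≡ (x ∸ prev + suc (initialRun S)) ∷ laterBlocks S
gaps-cutsFrom prev x [] prev≤x = cong (_∷ []) (+-∸-comm 1 prev≤x)
gaps-cutsFrom {suc k} prev x (true ∷ S) prev≤x = begin
  gaps prev (cutsFrom x (true ∷ S)) (x + suc (suc k))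
    ≡⟨ cong (λ cs → gaps prev cs (x + suc (suc k))) (cutsFrom-∷ x true S) ⟩
  (x + 1 ∸ prev) ∷ gaps (x + 1) (cutsFrom (suc x) S) (x + suc (suc k))
    ≡⟨ cong₂ _∷_ (+-∸-comm 1 prev≤x)
                 (cong₂ (λ p N → gaps p (cutsFrom (suc x) S) N) (+-comm x 1) (+-suc x (suc k))) ⟩
  (x ∸ prev + 1) ∷ gaps (suc x) (cutsFrom (suc x) S) (suc x + suc k)
    ≡⟨ cong (x ∸ prev + 1 ∷_) (gaps-cutsFrom (suc x) (suc x) S ≤-refl) ⟩
  (x ∸ prev + 1) ∷ (x ∸ x + suc (initialRun S)) ∷ laterBlocks S
    ≡⟨ cong (λ d → x ∸ prev + 1 ∷ d + suc (initialRun S) ∷ laterBlocks S) (n∸n≡0 x) ⟩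
  (x ∸ prev + 1) ∷ suc (initialRun S) ∷ laterBlocks S ∎
  where open ≡-Reasoning
gaps-cutsFrom {suc k} prev x (false ∷ S) prev≤x = begin
  gaps prev (cutsFrom x (false ∷ S)) (x + suc (suc k))
    ≡⟨ cong₂ (gaps prev) (cutsFrom-∷ x false S) (+-suc x (suc k)) ⟩
  gaps prev (cutsFrom (suc x) S) (suc x + suc k)
    ≡⟨ gaps-cutsFrom prev (suc x) S (m≤n⇒m≤1+n prev≤x) ⟩
  (suc x ∸ prev + suc (initialRun S)) ∷ laterBlocks S
    ≡⟨ cong (λ d → d + suc (initialRun S) ∷ laterBlocks S) (+-∸-assoc 1 prev≤x) ⟩
  (suc (x ∸ prev) + suc (initialRun S)) ∷ laterBlocks S
    ≡⟨ cong (_∷ laterBlocks S) (+-suc (x ∸ prev) (suc (initialRun S))) ⟨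
  (x ∸ prev + suc (suc (initialRun S))) ∷ laterBlocks S ∎
  where open ≡-Reasoning

η≡product-blockSizes : ∀ {m} (S : Subset m) → η S ≡ product (map _! (blockSizes S))
η≡product-blockSizes S = cong (product ∘ map _!) (gaps-cutsFrom 0 0 S z≤n)

-- Descents only at cuts

-- w continues a word whose last letter is lo, and entry j of fs is the gap just before letter j of w.
descentsAtCuts : ∀ {n k} → ℕ → Vec Bool k → Vec (Fin n) k → Bool
descentsAtCuts lo []           []      = true
descentsAtCuts lo (true ∷ fs)  (a ∷ w) = descentsAtCuts (toℕ a) fs w
descentsAtCuts lo (false ∷ fs) (a ∷ w) = ⌊ lo ≤? toℕ a ⌋ ∧ descentsAtCuts (toℕ a) fs w

module _ (n : ℕ) where

  availFrom : List ℕ → ℕ → ℕ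
  availFrom U lo = avail n U (λ x → ⌊ lo ≤? x ⌋)

  availFrom-∷-self : ∀ U a → availFrom (a ∷ U) a ≡ availFrom U (suc a)
  availFrom-∷-self U a = ∑-cong n (λ x _ → pointwise x)
    where
    pointwise : ∀ x → 𝟙 ⌊ a ≤? x ⌋ * 𝟙 (not (⌊ x ≟ a ⌋ ∨ x ∈ᵇ U)) ≡ 𝟙 ⌊ suc a ≤? x ⌋ * 𝟙 (not (x ∈ᵇ U))
    pointwise x with x ≟ a | a ≤? x | suc a ≤? x
    ... | yes refl | _       | yes a<a  = contradiction a<a (n≮n a)
    ... | yes refl | yes _   | no _     = refl
    ... | yes refl | no _    | no _     = refl
    ... | no _     | yes _   | yes _    = refl
    ... | no x≢a   | yes a≤x | no a≮x   = contradiction (≤∧≢⇒< a≤x (x≢a ∘ sym)) a≮x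
    ... | no _     | no a≰x  | yes a<x  = contradiction (<⇒≤ a<x) a≰x
    ... | no _     | no _    | no _     = refl

  count-descentsAtCuts : ∀ {k} U lo (fs : Vec Bool k) →
    count (λ w → fresh U w ∧ descentsAtCuts lo fs w) (allWords {n} k)
      ≡ (availFrom U lo C initialRun fs) * multinomial (availFrom U 0 ∸ initialRun fs) (laterBlocks fs)

  count-block-∷ : ∀ {k} U lo s (fs : Vec Bool k) lo′ →
    (∀ a w → descentsAtCuts lo (s ∷ fs) (a ∷ w) ≡ ⌊ lo′ ≤? toℕ a ⌋ ∧ descentsAtCuts (toℕ a) fs w) →
    count (λ w → fresh U w ∧ descentsAtCuts lo (s ∷ fs) w) (allWords {n} (suc k))
      ≡ (availFrom U lo′ C suc (initialRun fs))
        * multinomial (availFrom U 0 ∸ suc (initialRun fs)) (laterBlocks fs)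

  count-descentsAtCuts U lo []           = refl
  count-descentsAtCuts U lo (false ∷ fs) = count-block-∷ U lo false fs lo (λ _ _ → refl)
  count-descentsAtCuts U lo (true ∷ fs)  =
    trans (count-block-∷ U lo true fs 0 (λ _ _ → refl)) (sym (*-identityˡ _))

  count-block-∷ {k} U lo s fs lo′ head-test = begin
    count (λ w → fresh U w ∧ descentsAtCuts lo (s ∷ fs) w) (allWords {n} (suc k))
      ≡⟨ count-fresh-∷ n U _ (λ x → ⌊ lo′ ≤? x ⌋) (λ x → descentsAtCuts x fs)
           (λ x → (availFrom U (suc x) C L) * M) head-test count-tail ⟩
    ∑[ x < n ] 𝟙 ⌊ lo′ ≤? x ⌋ * (𝟙 (not (x ∈ᵇ U)) * ((availFrom U (suc x) C L) * M))
      ≡⟨ ∑-cong n (λ x _ → reassoc (𝟙 ⌊ lo′ ≤? x ⌋) (𝟙 (not (x ∈ᵇ U))) (availFrom U (suc x) C L)) ⟩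
    ∑[ x < n ] 𝟙 ⌊ lo′ ≤? x ⌋ * (𝟙 (not (x ∈ᵇ U)) * (availFrom U (suc x) C L)) * M
      ≡⟨ ∑-distribʳ-* n _ M ⟩
    (∑[ x < n ] 𝟙 ⌊ lo′ ≤? x ⌋ * (𝟙 (not (x ∈ᵇ U)) * (availFrom U (suc x) C L))) * M
      ≡⟨ cong (_* M) (hockey-stick n (λ x → not (x ∈ᵇ U)) lo′ L) ⟩
    (availFrom U lo′ C suc L) * M ∎
    where
    open ≡-Reasoning
    L : ℕ
    L = initialRun fs
    M : ℕ
    M = multinomial (availFrom U 0 ∸ suc L) (laterBlocks fs)
    reassoc : ∀ a b c → a * (b * (c * M)) ≡ a * (b * c) * M
    reassoc a b c = trans (cong (a *_) (sym (*-assoc b c M))) (sym (*-assoc a (b * c) M))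
    count-tail : ∀ x → x < n → T ⌊ lo′ ≤? x ⌋ → T (not (x ∈ᵇ U)) →
      count (λ w → fresh (x ∷ U) w ∧ descentsAtCuts x fs w) (allWords {n} k) ≡ (availFrom U (suc x) C L) * M
    count-tail x x<n _ x∉U = trans (count-descentsAtCuts (x ∷ U) x fs)
      (cong₂ (λ A B → (A C L) * multinomial B (laterBlocks fs))
             (availFrom-∷-self U x) (avail-∷-∸ n U (λ y → ⌊ 0 ≤? y ⌋) x x<n _ x∉U L))

-- DsubsetOf S w is all (descentAllowed S w) (allFin m).
descentAllowed : ∀ {n k} → Vec Bool k → Vec (Fin n) (suc k) → Fin k → Bool
descentAllowed S w j = if ⌊ lookup w (fsuc j) <?ᶠ lookup w (inject₁ j) ⌋ then lookup S j else true

all-descentAllowed : ∀ {n k} (S : Vec Bool k) (a : Fin n) w →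
  all (descentAllowed S (a ∷ w)) (allFin k) ≡ descentsAtCuts (toℕ a) S w
all-descentAllowed []      a []      = refl
all-descentAllowed (s ∷ S) a (b ∷ w) =
  trans (all-allFin-suc (descentAllowed (s ∷ S) (a ∷ b ∷ w)))
        (trans (cong (descentAllowed (s ∷ S) (a ∷ b ∷ w) fzero ∧_) (all-descentAllowed S b w)) (first-gap s))
  where
  first-gap : ∀ s → (if ⌊ b <?ᶠ a ⌋ then s else true) ∧ descentsAtCuts (toℕ b) S w
                      ≡ descentsAtCuts (toℕ a) (s ∷ S) (b ∷ w)
  first-gap true with b <?ᶠ a
  ... | yes _ = refl
  ... | no _  = refl
  first-gap false with b <?ᶠ a | toℕ a ≤? toℕ b
  ... | yes b<a | yes a≤b = contradiction b<a (≤⇒≯ a≤b)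
  ... | yes _   | no _    = refl
  ... | no _    | yes _   = refl
  ... | no b≮a  | no a≰b  = contradiction (≮⇒≥ b≮a) a≰b

DsubsetOf≡descentsAtCuts : ∀ {m} (S : Subset m) w → DsubsetOf S w ≡ descentsAtCuts 0 (true ∷ S) w
DsubsetOf≡descentsAtCuts S (a ∷ w) = all-descentAllowed S a w

#𝔖-DsubsetOf : ∀ m (S : Subset m) → #𝔖 (suc m) (DsubsetOf S) ≡ multinomial (suc m) (blockSizes S)
#𝔖-DsubsetOf m S = begin
  #𝔖 (suc m) (DsubsetOf S)
    ≡⟨ #𝔖≡count (suc m) (DsubsetOf S) ⟩
  count (λ w → fresh [] w ∧ DsubsetOf S w) (allWords {suc m} (suc m))
    ≡⟨ count-cong (λ w → cong (fresh [] w ∧_) (DsubsetOf≡descentsAtCuts S w)) (allWords {suc m} (suc m)) ⟩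
  count (λ w → fresh [] w ∧ descentsAtCuts 0 (true ∷ S) w) (allWords {suc m} (suc m))
    ≡⟨ count-descentsAtCuts (suc m) [] 0 (true ∷ S) ⟩
  1 * multinomial (availFrom (suc m) [] 0) (blockSizes S)
    ≡⟨ *-identityˡ _ ⟩
  multinomial (availFrom (suc m) [] 0) (blockSizes S)
    ≡⟨ cong (λ M → multinomial M (blockSizes S)) (∑-const (suc m)) ⟩
  multinomial (suc m) (blockSizes S) ∎
  where open ≡-Reasoning

-- Connectivity at every cut

Connected : ∀ {n} → (Fin n → Fin n) → ℕ → Set
Connected f i = ∀ x y → toℕ x < i → i ≤ toℕ y → toℕ (f x) < toℕ (f y)

PrefixClosed : ∀ {n} → (Fin n → Fin n) → ℕ → Set
PrefixClosed f i = ∀ p → toℕ p < i → toℕ (f p) < i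

module _ {n : ℕ} where

  injective-window : ∀ {a} (h : Fin a → Fin n) lo b → Injective _≡_ _≡_ h →
    (∀ k → lo ≤ toℕ (h k)) → (∀ k → toℕ (h k) < lo + b) → a ≤ b
  injective-window h lo b h-injective lo≤h h<lo+b = injective⇒≤ {f = shifted} shifted-injective
    where
    shifted<b : ∀ k → toℕ (h k) ∸ lo < b
    shifted<b k = subst (toℕ (h k) ∸ lo <_) (m+n∸m≡n lo b) (∸-monoˡ-< (h<lo+b k) (lo≤h k))
    shifted : Fin _ → Fin b
    shifted k = fromℕ< (shifted<b k)
    shifted-injective : Injective _≡_ _≡_ shifted
    shifted-injective {k} {l} eq = h-injective (toℕ-injective
      (∸-cancelʳ-≡ (lo≤h k) (lo≤h l) (fromℕ<-injective _ _ (shifted<b k) (shifted<b l) eq)))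

  ∷-injective : ∀ {a} (p : Fin n) (e : Fin a → Fin n) → Injective _≡_ _≡_ e → (∀ t → e t ≢ p) →
    Injective _≡_ _≡_ (p ∷ᶠ e)
  ∷-injective p e e-injective e≢p {fzero}  {fzero}  _  = refl
  ∷-injective p e e-injective e≢p {fzero}  {fsuc t} eq = contradiction (sym eq) (e≢p t)
  ∷-injective p e e-injective e≢p {fsuc s} {fzero}  eq = contradiction eq (e≢p s)
  ∷-injective p e e-injective e≢p {fsuc s} {fsuc t} eq = cong fsuc (e-injective eq)

  module _ (f : Fin n → Fin n) (f-injective : Injective _≡_ _≡_ f) where

    -- Otherwise f maps the suc i positions y, 0, …, i-1 injectively into [0, i).
    prefixClosed⇒suffixClosed : ∀ i → PrefixClosed f i → ∀ y → i ≤ toℕ y → i ≤ toℕ (f y)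
    prefixClosed⇒suffixClosed i closed y i≤y with i ≤? toℕ (f y)
    ... | yes i≤fy = i≤fy
    ... | no i≰fy  = contradiction
      (injective-window (f ∘ positions) 0 i (positions-injective ∘ f-injective) (λ _ → z≤n) in-prefix) (n≮n i)
      where
      i≤n : i ≤ n
      i≤n = ≤-trans i≤y (<⇒≤ (toℕ<n y))
      prefix : Fin i → Fin n
      prefix k = inject≤ k i≤n
      positions : Fin (suc i) → Fin n
      positions = y ∷ᶠ prefix
      positions-injective : Injective _≡_ _≡_ positions
      positions-injective = ∷-injective y prefix (inject≤-injective _ _ _ _)
        (λ t eq → <⇒≱ (subst (_< i) (trans (sym (toℕ-inject≤ t i≤n)) (cong toℕ eq)) (toℕ<n t)) i≤y)
      in-prefix : ∀ k → toℕ (f (positions k)) < i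
      in-prefix fzero    = ≰⇒> i≰fy
      in-prefix (fsuc k) = closed (prefix k) (subst (_< i) (sym (toℕ-inject≤ k i≤n)) (toℕ<n k))

    -- Otherwise f maps the positions x, i, …, n-1 injectively into [i, n): f x ≥ i and every later letter exceeds f x.
    connected⇒prefixClosed : ∀ i → i ≤ n → Connected f i → PrefixClosed f i
    connected⇒prefixClosed i i≤n connected x x<i with toℕ (f x) <? i
    ... | yes fx<i = fx<i
    ... | no fx≮i  = contradiction
      (injective-window (f ∘ positions) i (n ∸ i) (positions-injective ∘ f-injective) in-suffix below-n) (n≮n (n ∸ i))
      where
      i+t<n : (t : Fin (n ∸ i)) → i + toℕ t < n
      i+t<n t = subst (i + toℕ t <_) (m+[n∸m]≡n i≤n) (+-monoʳ-< i (toℕ<n t))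
      suffix : Fin (n ∸ i) → Fin n
      suffix t = fromℕ< (i+t<n t)
      i≤suffix : ∀ t → i ≤ toℕ (suffix t)
      i≤suffix t = subst (i ≤_) (sym (toℕ-fromℕ< (i+t<n t))) (m≤m+n i (toℕ t))
      suffix-injective : Injective _≡_ _≡_ suffix
      suffix-injective {s} {t} eq = toℕ-injective (+-cancelˡ-≡ i _ _ (fromℕ<-injective _ _ (i+t<n s) (i+t<n t) eq))
      positions : Fin (suc (n ∸ i)) → Fin n
      positions = x ∷ᶠ suffix
      positions-injective : Injective _≡_ _≡_ positions
      positions-injective = ∷-injective x suffix suffix-injective
        (λ t eq → <⇒≱ x<i (subst (i ≤_) (cong toℕ eq) (i≤suffix t)))
      in-suffix : ∀ k → i ≤ toℕ (f (positions k))
      in-suffix fzero    = ≮⇒≥ fx≮i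
      in-suffix (fsuc t) = <⇒≤ (≤-<-trans (≮⇒≥ fx≮i) (connected x (suffix t) x<i (i≤suffix t)))
      below-n : ∀ k → toℕ (f (positions k)) < i + (n ∸ i)
      below-n k = subst (toℕ (f (positions k)) <_) (sym (m+[n∸m]≡n i≤n)) (toℕ<n _)

connected⇔prefixClosed : ∀ {n} (f : Fin n → Fin n) → Injective _≡_ _≡_ f → ∀ i → i ≤ n →
  Connected f i ⇔ PrefixClosed f i
connected⇔prefixClosed f f-injective i i≤n = mk⇔
  (connected⇒prefixClosed f f-injective i i≤n)
  (λ closed x y x<i i≤y → <-≤-trans (closed x x<i) (prefixClosed⇒suffixClosed f f-injective i closed y i≤y))

isConnected⇔ : ∀ {n} (w : Vec (Fin n) n) i → T (isConnected w i) ⇔ Connected (lookup w) i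
isConnected⇔ {n} w i = mk⇔
  (λ t x y x<i i≤y → to (entry x y)
     (to (T-all-allFin (test x)) (to (T-all-allFin row) t x) y) x<i i≤y)
  (λ connected → from (T-all-allFin row) λ x → from (T-all-allFin (test x)) λ y →
     from (entry x y) (connected x y))
  where
  test : Fin n → Fin n → Bool
  test x y = if ⌊ toℕ x <? i ⌋ ∧ ⌊ i ≤? toℕ y ⌋ then ⌊ lookup w x <?ᶠ lookup w y ⌋ else true
  row : Fin n → Bool
  row x = all (test x) (allFin n)
  entry : ∀ x y → T (test x y) ⇔ (toℕ x < i → i ≤ toℕ y → toℕ (lookup w x) < toℕ (lookup w y))
  entry x y = T-if-dec₂ (toℕ x <? i) (i ≤? toℕ y) (lookup w x <?ᶠ lookup w y)

subsetOfC⇔ : ∀ {m} (S : Subset m) w →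
  T (subsetOfC S w) ⇔ (∀ j → T (lookup S j) → T (isConnected w (suc (toℕ j))))
subsetOfC⇔ S w = mk⇔
  (λ t j → to (T-if-then-true (lookup S j) _) (to (T-all-allFin _) t j))
  (λ h → from (T-all-allFin _) λ j → from (T-if-then-true (lookup S j) _) (h j))

belowCuts : ∀ {k} → ℕ → Vec Bool k → ℕ → Bool
belowCuts x []           a = true
belowCuts x (true ∷ fs)  a = ⌊ a ≤? x ⌋ ∧ belowCuts (suc x) fs a
belowCuts x (false ∷ fs) a = belowCuts (suc x) fs a

-- The letters of w sit at positions x, x+1, …; each must be at most every cut position at or after its own.
underCuts : ∀ {n k} → ℕ → Vec Bool k → Vec (Fin n) (suc k) → Bool
underCuts x []       (a ∷ []) = true
underCuts x (f ∷ fs) (a ∷ w)  = belowCuts x (f ∷ fs) (toℕ a) ∧ underCuts (suc x) fs w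

belowCuts-∷ : ∀ {k} x f (fs : Vec Bool k) a → T (belowCuts x (f ∷ fs) a) → T (belowCuts (suc x) fs a)
belowCuts-∷ x true  fs a below = proj₂ (to T-∧ below)
belowCuts-∷ x false fs a below = below

belowCuts-≤ : ∀ {k} x (fs : Vec Bool k) a → a ≤ x → belowCuts x fs a ≡ true
belowCuts-≤ x []           a a≤x = refl
belowCuts-≤ x (true ∷ fs)  a a≤x with a ≤? x
... | yes _   = belowCuts-≤ (suc x) fs a (m≤n⇒m≤1+n a≤x)
... | no a≰x  = contradiction a≤x a≰x
belowCuts-≤ x (false ∷ fs) a a≤x = belowCuts-≤ (suc x) fs a (m≤n⇒m≤1+n a≤x)

-- The next cut lies initialRun fs positions after x.
belowCuts≡<? : ∀ {k} x (fs : Vec Bool k) a → a < x + suc k →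
  belowCuts x fs a ≡ ⌊ a <? suc (initialRun fs + x) ⌋
belowCuts≡<? x [] a a<x+1 with a <? suc x
... | yes _   = refl
... | no a≮x+1 = contradiction (subst (a <_) (+-comm x 1) a<x+1) a≮x+1
belowCuts≡<? x (true ∷ fs) a _ with a ≤? x | a <? suc x
... | yes a≤x | yes _     = belowCuts-≤ (suc x) fs a (m≤n⇒m≤1+n a≤x)
... | yes a≤x | no a≮x+1  = contradiction (s≤s a≤x) a≮x+1
... | no a≰x  | yes a<x+1 = contradiction (s≤s⁻¹ a<x+1) a≰x
... | no _    | no _      = refl
belowCuts≡<? {suc k} x (false ∷ fs) a a<x+2+k =
  trans (belowCuts≡<? (suc x) fs a (subst (a <_) (+-suc x (suc k)) a<x+2+k))
        (cong (λ b → ⌊ a <? suc b ⌋) (+-suc (initialRun fs) x))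

belowCuts⇔ : ∀ {k} x (fs : Vec Bool k) a → T (belowCuts x fs a) ⇔ (∀ j → T (lookup fs j) → a ≤ x + toℕ j)
belowCuts⇔ x [] a = mk⇔ (λ _ ()) (λ _ → _)
belowCuts⇔ x (true ∷ fs) a = mk⇔
  (λ t → let a≤x , below = to T-∧ t in λ
    { fzero    _   → subst (a ≤_) (sym (+-identityʳ x)) (toWitness a≤x)
    ; (fsuc j) cut → subst (a ≤_) (sym (+-suc x (toℕ j))) (to (belowCuts⇔ (suc x) fs a) below j cut) })
  (λ h → from T-∧ (fromWitness (subst (a ≤_) (+-identityʳ x) (h fzero _)) ,
    from (belowCuts⇔ (suc x) fs a) (λ j cut → subst (a ≤_) (+-suc x (toℕ j)) (h (fsuc j) cut))))
belowCuts⇔ x (false ∷ fs) a = mk⇔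
  (λ t → λ { (fsuc j) cut → subst (a ≤_) (sym (+-suc x (toℕ j))) (to (belowCuts⇔ (suc x) fs a) t j cut) })
  (λ h → from (belowCuts⇔ (suc x) fs a) (λ j cut → subst (a ≤_) (+-suc x (toℕ j)) (h (fsuc j) cut)))

UnderCuts : ∀ {n k} → ℕ → Vec Bool k → Vec (Fin n) (suc k) → Set
UnderCuts x fs w = ∀ j → T (lookup fs j) → ∀ p → toℕ p ≤ toℕ j → toℕ (lookup w p) ≤ x + toℕ j

underCuts⇔ : ∀ {n k} x (fs : Vec Bool k) (w : Vec (Fin n) (suc k)) → T (underCuts x fs w) ⇔ UnderCuts x fs w
underCuts⇔ x []       (a ∷ []) = mk⇔ (λ _ ()) (λ _ → _)
underCuts⇔ x (f ∷ fs) (a ∷ w)  = mk⇔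
  (λ t → let below , under = to T-∧ t in λ
    { j        cut fzero    _         → to (belowCuts⇔ x (f ∷ fs) (toℕ a)) below j cut
    ; (fsuc j) cut (fsuc p) (s≤s p≤j) → subst (toℕ (lookup w p) ≤_) (sym (+-suc x (toℕ j)))
                                          (to (underCuts⇔ (suc x) fs w) under j cut p p≤j) })
  (λ h → from T-∧
    ( from (belowCuts⇔ x (f ∷ fs) (toℕ a)) (λ j cut → h j cut fzero z≤n)
    , from (underCuts⇔ (suc x) fs w)
        (λ j cut p p≤j → subst (toℕ (lookup w p) ≤_) (+-suc x (toℕ j)) (h (fsuc j) cut (fsuc p) (s≤s p≤j)))))

subsetOfC≡underCuts : ∀ {m} (S : Subset m) (w : Vec (Fin (suc m)) (suc m)) → Injective _≡_ _≡_ (lookup w) →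
  subsetOfC S w ≡ underCuts 0 S w
subsetOfC≡underCuts S w w-injective = T-⇔⇒≡
  (λ t → from (underCuts⇔ 0 S w) λ j cut p p≤j → s≤s⁻¹
     (to (closed⇔ j) (to (isConnected⇔ w _) (to (subsetOfC⇔ S w) t j cut)) p (s≤s p≤j)))
  (λ t → from (subsetOfC⇔ S w) λ j cut → from (isConnected⇔ w _)
     (from (closed⇔ j) λ p p≤j → s≤s (to (underCuts⇔ 0 S w) t j cut p (s≤s⁻¹ p≤j))))
  where
  closed⇔ : ∀ j → Connected (lookup w) (suc (toℕ j)) ⇔ PrefixClosed (lookup w) (suc (toℕ j))
  closed⇔ j = connected⇔prefixClosed (lookup w) w-injective (suc (toℕ j)) (s≤s (<⇒≤ (toℕ<n j)))

module _ (n : ℕ) where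

  -- The letters placed so far all lie below every later bound, so `used` of the letters counted by avail are taken.
  underCutsCount : ∀ {k} → List ℕ → ℕ → ℕ → Vec Bool k → ℕ
  underCutsCount U used x []       = avail n U (belowCuts x []) ∸ used
  underCutsCount U used x (f ∷ fs) =
    (avail n U (belowCuts x (f ∷ fs)) ∸ used) * underCutsCount U (suc used) (suc x) fs

  underCutsCount-∷ : ∀ {k} U a used x (fs : Vec Bool k) → a < n → T (not (a ∈ᵇ U)) → T (belowCuts x fs a) →
    underCutsCount (a ∷ U) used x fs ≡ underCutsCount U (suc used) x fs
  underCutsCount-∷ U a used x []       a<n a∉U below = avail-∷-∸ n U (belowCuts x []) a a<n below a∉U used
  underCutsCount-∷ U a used x (f ∷ fs) a<n a∉U below =
    cong₂ _*_ (avail-∷-∸ n U (belowCuts x (f ∷ fs)) a a<n below a∉U used)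
              (underCutsCount-∷ U a (suc used) (suc x) fs a<n a∉U (belowCuts-∷ x f fs a below))

  count-underCuts : ∀ {k} U x (fs : Vec Bool k) →
    count (λ w → fresh U w ∧ underCuts x fs w) (allWords {n} (suc k)) ≡ underCutsCount U 0 x fs
  count-underCuts U x [] =
    trans (count-fresh-∷ n U _ (λ _ → true) (λ _ _ → true) (λ _ → 1) (λ { a [] → refl }) (λ _ _ _ _ → refl))
          (∑-cong n (λ y _ → cong (1 *_) (*-identityʳ _)))
  count-underCuts U x (f ∷ fs) = begin
    count (λ w → fresh U w ∧ underCuts x (f ∷ fs) w) (allWords {n} (suc (suc _)))
      ≡⟨ count-fresh-∷ n U _ (belowCuts x (f ∷ fs)) (λ _ → underCuts (suc x) fs) (λ _ → rest)
           (λ _ _ → refl) count-tail ⟩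
    ∑[ y < n ] 𝟙 (belowCuts x (f ∷ fs) y) * (𝟙 (not (y ∈ᵇ U)) * rest)
      ≡⟨ ∑-cong n (λ y _ → sym (*-assoc (𝟙 (belowCuts x (f ∷ fs) y)) _ rest)) ⟩
    ∑[ y < n ] 𝟙 (belowCuts x (f ∷ fs) y) * 𝟙 (not (y ∈ᵇ U)) * rest
      ≡⟨ ∑-distribʳ-* n _ rest ⟩
    avail n U (belowCuts x (f ∷ fs)) * rest ∎
    where
    open ≡-Reasoning
    rest : ℕ
    rest = underCutsCount U 1 (suc x) fs
    count-tail : ∀ y → y < n → T (belowCuts x (f ∷ fs) y) → T (not (y ∈ᵇ U)) →
      count (λ w → fresh (y ∷ U) w ∧ underCuts (suc x) fs w) (allWords {n} (suc _)) ≡ rest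
    count-tail y y<n below y∉U =
      trans (count-underCuts (y ∷ U) (suc x) fs)
            (underCutsCount-∷ U y 0 (suc x) fs y<n y∉U (belowCuts-∷ x f fs y below))

  avail-[]-∸ : ∀ {k} x (fs : Vec Bool k) → x + suc k ≡ n →
    avail n [] (belowCuts x fs) ∸ x ≡ suc (initialRun fs)
  avail-[]-∸ {k} x fs x+k+1≡n = begin
    avail n [] (belowCuts x fs) ∸ x
      ≡⟨ cong (_∸ x) (∑-cong n λ y y<n → trans (*-identityʳ _)
           (cong 𝟙 (belowCuts≡<? x fs y (subst (y <_) (sym x+k+1≡n) y<n)))) ⟩
    (∑[ y < n ] 𝟙 ⌊ y <? suc (initialRun fs + x) ⌋) ∸ x
      ≡⟨ cong (_∸ x) (∑-below n _ (subst (suc (initialRun fs + x) ≤_) x+k+1≡n bound)) ⟩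
    suc (initialRun fs + x) ∸ x
      ≡⟨ m+n∸n≡m (suc (initialRun fs)) x ⟩
    suc (initialRun fs) ∎
    where
    open ≡-Reasoning
    bound : suc (initialRun fs + x) ≤ x + suc k
    bound = subst (suc (initialRun fs + x) ≤_) (+-comm (suc k) x) (s≤s (+-monoˡ-≤ x (initialRun≤ fs)))

  underCutsCount-[] : ∀ {k} x (fs : Vec Bool k) → x + suc k ≡ n →
    underCutsCount [] x x fs ≡ product (map _! (blockSizes fs))
  underCutsCount-[] x []       x+1≡n = avail-[]-∸ x [] x+1≡n
  underCutsCount-[] {suc k} x (f ∷ fs) x+k+2≡n = begin
    (avail n [] (belowCuts x (f ∷ fs)) ∸ x) * underCutsCount [] (suc x) (suc x) fs
      ≡⟨ cong₂ _*_ (avail-[]-∸ x (f ∷ fs) x+k+2≡n)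
                   (underCutsCount-[] (suc x) fs (trans (sym (+-suc x (suc k))) x+k+2≡n)) ⟩
    suc (initialRun (f ∷ fs)) * product (map _! (blockSizes fs))
      ≡⟨ blockSizes-∷ f fs ⟩
    product (map _! (blockSizes (f ∷ fs))) ∎
    where open ≡-Reasoning

#𝔖-subsetOfC : ∀ m (S : Subset m) → #𝔖 (suc m) (subsetOfC S) ≡ product (map _! (blockSizes S))
#𝔖-subsetOfC m S = begin
  #𝔖 (suc m) (subsetOfC S)
    ≡⟨ #𝔖≡count (suc m) (subsetOfC S) ⟩
  count (λ w → fresh [] w ∧ subsetOfC S w) (allWords {suc m} (suc m))
    ≡⟨ count-cong pointwise (allWords {suc m} (suc m)) ⟩
  count (λ w → fresh [] w ∧ underCuts 0 S w) (allWords {suc m} (suc m))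
    ≡⟨ count-underCuts (suc m) [] 0 S ⟩
  underCutsCount (suc m) [] 0 0 S
    ≡⟨ underCutsCount-[] (suc m) 0 S refl ⟩
  product (map _! (blockSizes S)) ∎
  where
  open ≡-Reasoning
  pointwise : ∀ w → fresh [] w ∧ subsetOfC S w ≡ fresh [] w ∧ underCuts 0 S w
  pointwise w with fresh [] w in eq
  ... | true  = subsetOfC≡underCuts S w (proj₁ (fresh⇒ [] w (subst T (sym eq) _)))
  ... | false = refl

multinomial*η : ∀ {m} (S : Subset m) → multinomial (suc m) (blockSizes S) * η S ≡ (suc m) !
multinomial*η {m} S = begin
  multinomial (suc m) (blockSizes S) * η S
    ≡⟨ cong (multinomial (suc m) (blockSizes S) *_) (η≡product-blockSizes S) ⟩
  multinomial (suc m) (blockSizes S) * product (map _! (blockSizes S))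
    ≡⟨ cong (λ N → multinomial N (blockSizes S) * product (map _! (blockSizes S))) (sum-blockSizes S) ⟨
  multinomial (sum (blockSizes S)) (blockSizes S) * product (map _! (blockSizes S))
    ≡⟨ multinomial-factorials (blockSizes S) ⟩
  sum (blockSizes S) !
    ≡⟨ cong _! (sum-blockSizes S) ⟩
  (suc m) ! ∎
  where open ≡-Reasoning

mainTheorem1 : (m : ℕ) (S : Subset m) →
    (#𝔖 (suc m) (subsetOfC S) ≡ η S) × (#𝔖 (suc m) (DsubsetOf S) ≡ ((suc m) ! / η S) {{η≢0 S}})
mainTheorem1 m S = trans (#𝔖-subsetOfC m S) (sym (η≡product-blockSizes S)) , descents
  where
  instance
    η-nonZero : NonZero (η S)
    η-nonZero = η≢0 S
  open ≡-Reasoning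
  descents : #𝔖 (suc m) (DsubsetOf S) ≡ (suc m) ! / η S
  descents = begin
    #𝔖 (suc m) (DsubsetOf S)                        ≡⟨ #𝔖-DsubsetOf m S ⟩
    multinomial (suc m) (blockSizes S)              ≡⟨ m*n/n≡m _ (η S) ⟨
    multinomial (suc m) (blockSizes S) * η S / η S  ≡⟨ cong (_/ η S) (multinomial*η S) ⟩
    (suc m) ! / η S                                 ∎
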